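{- If $n\ge 3$, then (i) $\mu^{ - }_t(S(K_n))=0$, and (ii) $\mu^{ - }(S(K_n))=n$.
   Context: $S(K_n)$ is the graph obtained from the complete graph $K_n$ by subdividing each edge exactly once. For $X\subseteq V(G)$, two vertices $a,b$ are $X$-visible if there is a shortest $a,b$-path $P$ with $V(P)\cap X\subseteq\{a,b\}$. $X$ is a mutual-visibility set if every two vertices of $X$ are $X$-visible, and a total mutual-visibility set if every two vertices of $G$ are $X$-visible; such a set is maximal if no proper superset has the same property (the empty set is allowed as a total mutual-visibility set). $\mu^{ - }(G)$ (resp. $\mu^{ - }_t(G)$) is the minimum cardinality of a maximal mutual-visibility (resp. maximal total mutual-visibility) set. -}

module Defs where

open import Level using (0ℓ)
open import Data.Nat using (ℕ; zero; suc; _≤_)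
open import Data.Fin using (Fin)
import Data.Fin as F
open import Data.Product using (Σ; ∃; _×_; _,_)
open import Data.Sum using (_⊎_; inj₁; inj₂)
open import Data.Empty using (⊥)
open import Data.Unit using (⊤)
open import Data.List using (List; length)
open import Data.List.Membership.Propositional using (_∈_; _∉_)
open import Data.List.Relation.Binary.Subset.Propositional using (_⊆_)
open import Data.List.Relation.Unary.Unique.Propositional using (Unique)
open import Relation.Binary.PropositionalEquality using (_≡_)
open import Relation.Nullary using (¬_)

record Graph : Set₁ where
  field
    V   : Set
    Adj : V → V → Set
open Graph public

module _ (G : Graph) where

  data Walk : V G → V G → Set where
    nil  : ∀ {a} → Walk a a
    cons : ∀ {a b c} → Adj G a b → Walk b c → Walk a c

  walkLength : ∀ {a c} → Walk a c → ℕ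
  walkLength nil        = 0
  walkLength (cons _ w) = suc (walkLength w)

  -- Every internal vertex of the walk lies outside X
  -- (i.e. V(P) ∩ X ⊆ {a, b} for a shortest, hence simple, path P).
  InteriorAvoids : List (V G) → ∀ {a c} → Walk a c → Set
  InteriorAvoids X nil = ⊤
  InteriorAvoids X (cons _ nil) = ⊤
  InteriorAvoids X (cons {b = b} _ (cons e w)) = (b ∉ X) × InteriorAvoids X (cons e w)

  IsShortest : ∀ {a c} → Walk a c → Set
  IsShortest {a} {c} w = ∀ (w' : Walk a c) → walkLength w ≤ walkLength w'

  Visible : List (V G) → V G → V G → Set
  Visible X a b = Σ (Walk a b) λ P → IsShortest P × InteriorAvoids X P

  -- finite vertex sets are duplicate-free lists; cardinality = length
  IsMutualVisibility : List (V G) → Set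
  IsMutualVisibility X = ∀ a b → a ∈ X → b ∈ X → Visible X a b

  IsTotalMutualVisibility : List (V G) → Set
  IsTotalMutualVisibility X = ∀ a b → Visible X a b

  ProperSuperset : List (V G) → List (V G) → Set
  ProperSuperset Y X = X ⊆ Y × ∃ λ v → v ∈ Y × v ∉ X

  IsMaximal : (List (V G) → Set) → List (V G) → Set
  IsMaximal P X = Unique X × P X ×
    (∀ Y → Unique Y → ProperSuperset Y X → ¬ P Y)

  IsMinMaximalCard : (List (V G) → Set) → ℕ → Set
  IsMinMaximalCard P m =
    (∃ λ X → IsMaximal P X × length X ≡ m) ×
    (∀ X → IsMaximal P X → m ≤ length X)

  MuMinus : ℕ → Set
  MuMinus = IsMinMaximalCard IsMutualVisibility

  MuTMinus : ℕ → Set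
  MuTMinus = IsMinMaximalCard IsTotalMutualVisibility

-- S(K_n): vertices are the n original vertices and one subdivision vertex
-- for each pair i < j; i is adjacent to the subdivision vertex of {i,j}.
SKV : ℕ → Set
SKV n = Fin n ⊎ Σ (Fin n × Fin n) (λ { (i , j) → i F.< j })

SKAdj : ∀ n → SKV n → SKV n → Set
SKAdj n (inj₁ k) (inj₂ ((i , j) , _)) = k ≡ i ⊎ k ≡ j
SKAdj n (inj₂ ((i , j) , _)) (inj₁ k) = k ≡ i ⊎ k ≡ j
SKAdj n (inj₁ _) (inj₁ _) = ⊥
SKAdj n (inj₂ _) (inj₂ _) = ⊥

SK : ℕ → Graph
SK n = record { V = SKV n ; Adj = SKAdj n }

-- Geodesics in S(K_n) have length at most 4 and explicit interiors, so the X-visibility of each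
-- kind of pair of vertices reduces to a combinatorial condition on X.
--
-- (i) No vertex blocks anything in ∅, but every vertex blocks some pair: a branch vertex i blocks the
-- subdivision vertices of two edges at i (here n ≥ 3 is used), a subdivision vertex its two ends.
--
-- (ii) The n branch vertices form a maximal mutual-visibility set. Conversely, read the subdivision
-- vertices of a maximal X as a graph on Fin n. A branch vertex outside X that is isolated in this
-- graph, or a leaf of it in a locally tree-like position, could be added to X, contradicting
-- maximality. Hence every branch vertex outside X can be paid a whole edge of X or two halves of
-- edges, each edge paying out at most its two halves; counting halves gives 2n ≤ 2|X|.

module Submission where

open import Defs
open import Data.Bool using (Bool; true; false; if_then_else_)
open import Data.Empty using (⊥; ⊥-elim)
open import Data.Fin using (Fin)
import Data.Fin as F
import Data.Fin.Properties as FP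
open import Data.List using (List; []; _∷_; length; map; allFin; _++_; lookup)
open import Data.List.Membership.Propositional using (_∈_; _∉_; find; lose)
import Data.List.Membership.DecPropositional as DecMembership
open import Data.List.Membership.Propositional.Properties
  using (∈-map⁺; ∈-map⁻; ∈-allFin; ∈-++⁺ˡ; ∈-++⁺ʳ)
import Data.List.Properties as LP
open import Data.List.Relation.Unary.All.Properties using (¬Any⇒All¬)
open import Data.List.Relation.Unary.AllPairs using ([]; _∷_)
open import Data.List.Relation.Unary.Any using (Any; here; there; any?; index)
open import Data.List.Relation.Unary.Any.Properties using (lookup-index)
open import Data.List.Relation.Unary.Unique.Propositional using (Unique)
import Data.List.Relation.Unary.Unique.Propositional.Properties as UP
open import Data.Nat using (ℕ; suc; _+_; _≤_; _<_; z≤n; s≤s)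
import Data.Nat.Properties as NP
open import Data.Product using (Σ; Σ-syntax; _×_; _,_; proj₁; proj₂)
import Data.Product.Properties as ×
open import Data.Sum using (_⊎_; inj₁; inj₂; [_,_]′; swap; reduce)
import Data.Sum.Properties as ⊎
open import Data.Unit using (tt)
open import Relation.Binary.Definitions using (DecidableEquality; tri<; tri≈; tri>)
open import Function using (id; _∘_)
open import Relation.Binary.PropositionalEquality
open import Relation.Nullary using (¬_; Dec; yes; no; does)
open import Relation.Nullary.Decidable
  using (_⊎-dec_; _×-dec_; _→-dec_; ¬?; map′; decidable-stable; dec-true; dec-false)

∉-∷ : ∀ {A : Set} {x y : A} {xs} → x ≢ y → x ∉ xs → x ∉ y ∷ xs
∉-∷ x≢y _   (here x≡y)  = x≢y x≡y
∉-∷ _   x∉xs (there x∈xs) = x∉xs x∈xs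

injection⇒≤length : ∀ {m} {A : Set} {xs : List A} (f : Fin m → A) →
                    (∀ {i j} → f i ≡ f j → i ≡ j) → (∀ i → f i ∈ xs) → m ≤ length xs
injection⇒≤length {xs = xs} f f-injective f∈xs =
  FP.injective⇒≤ {f = λ i → index (f∈xs i)} index-injective
  where
  index-injective : ∀ {i j} → index (f∈xs i) ≡ index (f∈xs j) → i ≡ j
  index-injective {i} {j} eq = f-injective (begin
    f i                          ≡⟨ lookup-index (f∈xs i) ⟩
    lookup xs (index (f∈xs i))   ≡⟨ cong (lookup xs) eq ⟩
    lookup xs (index (f∈xs j))   ≡⟨ lookup-index (f∈xs j) ⟨
    f j                          ∎)
    where open ≡-Reasoning

m+m≤n+n⇒m≤n : ∀ {m n} → m + m ≤ n + n → m ≤ n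
m+m≤n+n⇒m≤n {m} {n} le = subst₂ _≤_ (sym (NP.n≡⌊n+n/2⌋ m)) (sym (NP.n≡⌊n+n/2⌋ n)) (NP.⌊n/2⌋-mono le)

module _ {G : Graph} where

  snoc : ∀ {a b c} → Walk G a b → Adj G b c → Walk G a c
  snoc nil        e′ = cons e′ nil
  snoc (cons e w) e′ = cons e (snoc w e′)

  length-snoc : ∀ {a b c} (w : Walk G a b) (e : Adj G b c) →
                walkLength G (snoc w e) ≡ suc (walkLength G w)
  length-snoc nil        _  = refl
  length-snoc (cons _ w) e′ = cong suc (length-snoc w e′)

  avoids-snoc : ∀ {X a b c} (w : Walk G a b) (e : Adj G b c) → InteriorAvoids G X w →
                (0 < walkLength G w → b ∉ X) → InteriorAvoids G X (snoc w e)
  avoids-snoc nil                 _  _          _  = tt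
  avoids-snoc (cons _ nil)        _  _          b∉ = b∉ (s≤s z≤n) , tt
  avoids-snoc (cons _ (cons e w)) e′ (c∉ , av) b∉ =
    c∉ , avoids-snoc (cons e w) e′ av (λ _ → b∉ (s≤s z≤n))

  visible-refl : ∀ {X a} → Visible G X a a
  visible-refl = nil , (λ _ → z≤n) , tt

  visible-adjacent : ∀ {X a b} → a ≢ b → Adj G a b → Visible G X a b
  visible-adjacent {a = a} {b} a≢b e = cons e nil , nonempty , tt
    where
    nonempty : (w : Walk G a b) → 1 ≤ walkLength G w
    nonempty nil        = ⊥-elim (a≢b refl)
    nonempty (cons _ _) = s≤s z≤n

module _ {G : Graph} (Adj-sym : ∀ {a b} → Adj G a b → Adj G b a) where

  reverse : ∀ {a b} → Walk G a b → Walk G b a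
  reverse nil        = nil
  reverse (cons e w) = snoc (reverse w) (Adj-sym e)

  length-reverse : ∀ {a b} (w : Walk G a b) → walkLength G (reverse w) ≡ walkLength G w
  length-reverse nil        = refl
  length-reverse (cons e w) = trans (length-snoc (reverse w) (Adj-sym e)) (cong suc (length-reverse w))

  avoids-reverse : ∀ {X a b} (w : Walk G a b) → InteriorAvoids G X w → InteriorAvoids G X (reverse w)
  avoids-reverse nil                  _         = tt
  avoids-reverse (cons _ nil)         _         = tt
  avoids-reverse (cons e (cons e′ w)) (b∉ , av) =
    avoids-snoc (reverse (cons e′ w)) (Adj-sym e) (avoids-reverse (cons e′ w) av) (λ _ → b∉)

  visible-sym : ∀ {X a b} → Visible G X a b → Visible G X b a
  visible-sym (P , shortest , avoids) =
    reverse P ,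
    (λ w → subst₂ _≤_ (sym (length-reverse P)) (length-reverse w) (shortest (reverse w))) ,
    avoids-reverse P avoids

-- Shortest paths in S(K_n)

Edge : ℕ → Set
Edge n = Σ (Fin n × Fin n) λ { (i , j) → i F.< j }

-- orig i is the vertex i of K_n and mid e the subdivision vertex of its edge e.
pattern orig i = inj₁ i
pattern mid e  = inj₂ e

module _ {n : ℕ} where

  infix 4 _∈ₑ_ _∉ₑ_ _∈ₑ?_

  _∈ₑ_ : Fin n → Edge n → Set
  k ∈ₑ ((i , j) , _) = k ≡ i ⊎ k ≡ j

  _∉ₑ_ : Fin n → Edge n → Set
  k ∉ₑ e = ¬ k ∈ₑ e

  _∈ₑ?_ : ∀ k e → Dec (k ∈ₑ e)
  k ∈ₑ? ((i , j) , _) = (k F.≟ i) ⊎-dec (k F.≟ j)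

  _≟ₑ_ : DecidableEquality (Edge n)
  _≟ₑ_ = ×.≡-dec (×.≡-dec F._≟_ F._≟_) (λ p q → yes (FP.<-irrelevant p q))

  _≟ᵥ_ : DecidableEquality (SKV n)
  _≟ᵥ_ = ⊎.≡-dec F._≟_ _≟ₑ_

  Disjoint : Edge n → Edge n → Set
  Disjoint e f = ∀ {x} → x ∈ₑ e → x ∉ₑ f

  edge : (i j : Fin n) → i ≢ j → Edge n
  edge i j i≢j with FP.<-cmp i j
  ... | tri< i<j _ _ = (i , j) , i<j
  ... | tri≈ _ i≡j _ = ⊥-elim (i≢j i≡j)
  ... | tri> _ _ j<i = (j , i) , j<i

  ∈-edgeˡ : ∀ i j (i≢j : i ≢ j) → i ∈ₑ edge i j i≢j
  ∈-edgeˡ i j i≢j with FP.<-cmp i j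
  ... | tri< _ _ _   = inj₁ refl
  ... | tri≈ _ i≡j _ = ⊥-elim (i≢j i≡j)
  ... | tri> _ _ _   = inj₂ refl

  ∈-edgeʳ : ∀ i j (i≢j : i ≢ j) → j ∈ₑ edge i j i≢j
  ∈-edgeʳ i j i≢j with FP.<-cmp i j
  ... | tri< _ _ _   = inj₂ refl
  ... | tri≈ _ i≡j _ = ⊥-elim (i≢j i≡j)
  ... | tri> _ _ _   = inj₁ refl

  partner : ∀ {v} e → v ∈ₑ e → Σ[ w ∈ Fin n ] w ∈ₑ e × w ≢ v
  partner ((a , b) , a<b) (inj₁ refl) = b , inj₂ refl , (≢-sym (FP.<⇒≢ a<b))
  partner ((a , b) , a<b) (inj₂ refl) = a , inj₁ refl , FP.<⇒≢ a<b

  ∈ₑ∧∉ₑ⇒≢ : ∀ {x u} e → x ∈ₑ e → u ∉ₑ e → x ≢ u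
  ∈ₑ∧∉ₑ⇒≢ _ x∈e u∉e refl = u∉e x∈e

  ∈ₑ-two : ∀ {i j k} e → i ≢ j → i ∈ₑ e → j ∈ₑ e → k ∈ₑ e → k ≡ i ⊎ k ≡ j
  ∈ₑ-two _ i≢j (inj₁ refl) (inj₁ refl) _   = ⊥-elim (i≢j refl)
  ∈ₑ-two _ i≢j (inj₂ refl) (inj₂ refl) _   = ⊥-elim (i≢j refl)
  ∈ₑ-two _ _   (inj₁ refl) (inj₂ refl) k∈e = k∈e
  ∈ₑ-two _ _   (inj₂ refl) (inj₁ refl) k∈e = swap k∈e

  ∈ₑ-unique : ∀ {i j} e f → i ≢ j → i ∈ₑ e → j ∈ₑ e → i ∈ₑ f → j ∈ₑ f → e ≡ f
  ∈ₑ-unique {i} {j} e@((a , b) , a<b) f@((c , d) , c<d) i≢j = go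
    where
    same : ∀ {p q} → a ≡ c → b ≡ d → ((a , b) , p) ≡ ((c , d) , q)
    same refl refl = cong ((a , b) ,_) (FP.<-irrelevant _ _)
    go : i ∈ₑ e → j ∈ₑ e → i ∈ₑ f → j ∈ₑ f → e ≡ f
    go (inj₁ refl) (inj₁ refl) _           _           = ⊥-elim (i≢j refl)
    go (inj₂ refl) (inj₂ refl) _           _           = ⊥-elim (i≢j refl)
    go _           _           (inj₁ refl) (inj₁ refl) = ⊥-elim (i≢j refl)
    go _           _           (inj₂ refl) (inj₂ refl) = ⊥-elim (i≢j refl)
    go (inj₁ refl) (inj₂ refl) (inj₁ refl) (inj₂ refl) = same refl refl
    go (inj₂ refl) (inj₁ refl) (inj₂ refl) (inj₁ refl) = same refl refl
    go (inj₁ refl) (inj₂ refl) (inj₂ refl) (inj₁ refl) = ⊥-elim (FP.<-asym a<b c<d)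
    go (inj₂ refl) (inj₁ refl) (inj₁ refl) (inj₂ refl) = ⊥-elim (FP.<-asym a<b c<d)

  SK-sym : ∀ {a b} → Adj (SK n) a b → Adj (SK n) b a
  SK-sym {orig _} {mid _}  i∈e = i∈e
  SK-sym {mid _}  {orig _} i∈e = i∈e

  open DecMembership _≟ᵥ_ using (_∈?_)

  len : ∀ {a b} → Walk (SK n) a b → ℕ
  len = walkLength (SK n)

  walk≥2-orig : ∀ {i j} → i ≢ j → (w : Walk (SK n) (orig i) (orig j)) → 2 ≤ len w
  walk≥2-orig i≢j nil                = ⊥-elim (i≢j refl)
  walk≥2-orig _   (cons () nil)
  walk≥2-orig _   (cons _ (cons _ _)) = s≤s (s≤s z≤n)

  walk≥3-orig-mid : ∀ {i e} → i ∉ₑ e → (w : Walk (SK n) (orig i) (mid e)) → 3 ≤ len w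
  walk≥3-orig-mid i∉e (cons i∈e nil)                           = ⊥-elim (i∉e i∈e)
  walk≥3-orig-mid _   (cons {b = orig _} () (cons _ nil))
  walk≥3-orig-mid _   (cons {b = mid _} _ (cons () nil))
  walk≥3-orig-mid _   (cons _ (cons _ (cons _ _)))             = s≤s (s≤s (s≤s z≤n))

  walk≥2-mid : ∀ {e f} → e ≢ f → (w : Walk (SK n) (mid e) (mid f)) → 2 ≤ len w
  walk≥2-mid e≢f nil                 = ⊥-elim (e≢f refl)
  walk≥2-mid _   (cons () nil)
  walk≥2-mid _   (cons _ (cons _ _)) = s≤s (s≤s z≤n)

  walk≥4-disjoint : ∀ {e f} → Disjoint e f → (w : Walk (SK n) (mid e) (mid f)) → 4 ≤ len w
  walk≥4-disjoint {e} e∩f=∅ nil = ⊥-elim (e∩f=∅ {proj₁ (proj₁ e)} (inj₁ refl) (inj₁ refl))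
  walk≥4-disjoint _ (cons () nil)
  walk≥4-disjoint e∩f=∅ (cons {b = orig _} x∈e (cons x∈f nil)) = ⊥-elim (e∩f=∅ x∈e x∈f)
  walk≥4-disjoint _ (cons {b = mid _} () (cons _ nil))
  walk≥4-disjoint _ (cons {b = orig _} _ (cons {b = orig _} () (cons _ nil)))
  walk≥4-disjoint _ (cons {b = orig _} _ (cons {b = mid _} _ (cons () nil)))
  walk≥4-disjoint _ (cons {b = mid _} () (cons _ (cons _ nil)))
  walk≥4-disjoint _ (cons _ (cons _ (cons _ (cons _ _)))) = s≤s (s≤s (s≤s (s≤s z≤n)))

  through-mid : ∀ {i j} m → i ∈ₑ m → j ∈ₑ m → Walk (SK n) (orig i) (orig j)
  through-mid m i∈m j∈m = cons {b = mid m} i∈m (cons j∈m nil)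

  through-edge : ∀ i j → i ≢ j → Walk (SK n) (orig i) (orig j)
  through-edge i j i≢j = through-mid (edge i j i≢j) (∈-edgeˡ i j i≢j) (∈-edgeʳ i j i≢j)

  through-orig : ∀ {e f} x → x ∈ₑ e → x ∈ₑ f → Walk (SK n) (mid e) (mid f)
  through-orig x x∈e x∈f = cons {b = orig x} x∈e (cons x∈f nil)

  module _ (X : List (SKV n)) where

    -- The X-free interiors of shortest paths i – m – j, i – m – j – e and e – x – m – y – f.
    Clear : Fin n → Fin n → Set
    Clear i j = Σ[ m ∈ Edge n ] i ∈ₑ m × j ∈ₑ m × mid m ∉ X

    Route : Fin n → Edge n → Set
    Route i e = Σ[ j ∈ Fin n ] j ∈ₑ e × orig j ∉ X × Clear i j

    EdgeRoute : Edge n → Edge n → Set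
    EdgeRoute e f = Σ[ x ∈ Fin n ] x ∈ₑ e × orig x ∉ X × Route x f

    -- Adjacency in the graph on Fin n whose edges are the subdivision vertices in X.
    Joined : Fin n → Fin n → Set
    Joined i j = Σ[ m ∈ Edge n ] mid m ∈ X × i ∈ₑ m × j ∈ₑ m

    clear-via-edge : ∀ {i j} (i≢j : i ≢ j) → mid (edge i j i≢j) ∉ X → Clear i j
    clear-via-edge i≢j m∉X = edge _ _ i≢j , ∈-edgeˡ _ _ i≢j , ∈-edgeʳ _ _ i≢j , m∉X

    joined-sym : ∀ {i j} → Joined i j → Joined j i
    joined-sym (m , m∈X , i∈m , j∈m) = m , m∈X , j∈m , i∈m

    clear⊎joined : ∀ {i j} → i ≢ j → Clear i j ⊎ Joined i j
    clear⊎joined {i} {j} i≢j with mid (edge i j i≢j) ∈? X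
    ... | yes m∈X = inj₂ (edge i j i≢j , m∈X , ∈-edgeˡ i j i≢j , ∈-edgeʳ i j i≢j)
    ... | no m∉X  = inj₁ (clear-via-edge i≢j m∉X)

    edgeRoute-sym : ∀ {e f} → EdgeRoute e f → EdgeRoute f e
    edgeRoute-sym (x , x∈e , x∉ , y , y∈f , y∉ , m , x∈m , y∈m , m∉) =
      y , y∈f , y∉ , x , x∈e , x∉ , m , y∈m , x∈m , m∉

    clear⇒visible : ∀ {i j} → i ≢ j → Clear i j → Visible (SK n) X (orig i) (orig j)
    clear⇒visible i≢j (m , i∈m , j∈m , m∉) =
      through-mid m i∈m j∈m , walk≥2-orig i≢j , m∉ , tt

    route⇒visible : ∀ {i e} → i ∉ₑ e → Route i e → Visible (SK n) X (orig i) (mid e)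
    route⇒visible i∉e (j , j∈e , j∉ , m , i∈m , j∈m , m∉) =
      cons i∈m (cons j∈m (cons j∈e nil)) , walk≥3-orig-mid i∉e , m∉ , j∉ , tt

    junction⇒visible : ∀ {x e f} → e ≢ f → x ∈ₑ e → x ∈ₑ f → orig x ∉ X →
                       Visible (SK n) X (mid e) (mid f)
    junction⇒visible e≢f x∈e x∈f x∉ = through-orig _ x∈e x∈f , walk≥2-mid e≢f , x∉ , tt

    edgeRoute⇒visible : ∀ {e f} → Disjoint e f → EdgeRoute e f → Visible (SK n) X (mid e) (mid f)
    edgeRoute⇒visible e∩f=∅ (x , x∈e , x∉ , y , y∈f , y∉ , m , x∈m , y∈m , m∉) =
      cons x∈e (cons x∈m (cons y∈m (cons y∈f nil))) , walk≥4-disjoint e∩f=∅ , x∉ , m∉ , y∉ , tt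

    visible⇒clear : ∀ {i j} → i ≢ j → Visible (SK n) X (orig i) (orig j) → Clear i j
    visible⇒clear {i} {j} i≢j (P , shortest , avoids) = go P (shortest (through-edge i j i≢j)) avoids
      where
      go : (P : Walk (SK n) (orig i) (orig j)) → len P ≤ 2 → InteriorAvoids (SK n) X P → Clear i j
      go nil                                      _                 _        = ⊥-elim (i≢j refl)
      go (cons {b = mid m} i∈m (cons j∈m nil))    _                 (m∉ , _) = m , i∈m , j∈m , m∉
      go (cons _ (cons _ (cons _ _)))             (s≤s (s≤s ()))    _
      go (cons {b = orig _} () _)                 _                 _

    visible⇒route : ∀ {i e} → i ∉ₑ e → Visible (SK n) X (orig i) (mid e) → Route i e
    visible⇒route {i} {e} i∉e (P , shortest , avoids) = go P (shortest via-endpoint) avoids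
      where
      i≢a : i ≢ proj₁ (proj₁ e)
      i≢a i≡a = i∉e (inj₁ i≡a)
      via-endpoint : Walk (SK n) (orig i) (mid e)
      via-endpoint = snoc (through-edge i _ i≢a) (inj₁ refl)
      go : (P : Walk (SK n) (orig i) (mid e)) → len P ≤ 3 → InteriorAvoids (SK n) X P → Route i e
      go (cons {b = mid m} i∈m (cons {b = orig j} j∈m (cons j∈e nil))) _ (m∉ , j∉ , _) =
        j , j∈e , j∉ , m , i∈m , j∈m , m∉
      go (cons i∈e nil)                                 _                      _ = ⊥-elim (i∉e i∈e)
      go (cons {b = orig _} () _)                       _                      _
      go (cons {b = mid _} _ (cons {b = mid _} () _))   _                      _
      go (cons _ (cons _ (cons _ (cons _ _))))          (s≤s (s≤s (s≤s ()))) _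

    visible⇒free-junction : ∀ {x e f} → e ≢ f → x ∈ₑ e → x ∈ₑ f →
                            Visible (SK n) X (mid e) (mid f) → orig x ∉ X
    visible⇒free-junction {x} {e} {f} e≢f x∈e x∈f (P , shortest , avoids) =
      go P (shortest (through-orig x x∈e x∈f)) avoids
      where
      go : (P : Walk (SK n) (mid e) (mid f)) → len P ≤ 2 → InteriorAvoids (SK n) X P → orig x ∉ X
      go nil                                    _              _        = ⊥-elim (e≢f refl)
      go (cons {b = orig y} y∈e (cons y∈f nil)) _              (y∉ , _) with x F.≟ y
      ... | yes refl = y∉
      ... | no x≢y   = ⊥-elim (e≢f (∈ₑ-unique e f x≢y x∈e y∈e x∈f y∈f))
      go (cons {b = mid _} () _)                _              _
      go (cons _ (cons _ (cons _ _)))           (s≤s (s≤s ())) _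

    visible⇒edgeRoute : ∀ {e f} → Disjoint e f → Visible (SK n) X (mid e) (mid f) → EdgeRoute e f
    visible⇒edgeRoute {e} {f} e∩f=∅ (P , shortest , avoids) = go P (shortest via-endpoints) avoids
      where
      a≢c : proj₁ (proj₁ e) ≢ proj₁ (proj₁ f)
      a≢c a≡c = e∩f=∅ (inj₁ refl) (inj₁ a≡c)
      via-endpoints : Walk (SK n) (mid e) (mid f)
      via-endpoints = cons {b = orig _} (inj₁ refl) (snoc (through-edge _ _ a≢c) (inj₁ refl))
      go : (P : Walk (SK n) (mid e) (mid f)) → len P ≤ 4 → InteriorAvoids (SK n) X P → EdgeRoute e f
      go (cons {b = orig x} x∈e (cons {b = mid m} x∈m (cons {b = orig y} y∈m (cons y∈f nil))))
         _ (x∉ , m∉ , y∉ , _) = x , x∈e , x∉ , y , y∈f , y∉ , m , x∈m , y∈m , m∉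
      go nil                                                     _ _ = ⊥-elim (e∩f=∅ (inj₁ refl) (inj₁ refl))
      go (cons {b = orig _} x∈e (cons x∈f nil))                  _ _ = ⊥-elim (e∩f=∅ x∈e x∈f)
      go (cons {b = mid _} () _)                                 _ _
      go (cons {b = orig _} _ (cons {b = orig _} () _))          _ _
      go (cons {b = orig _} _ (cons {b = mid _} _ (cons {b = mid _} () _))) _ _
      go (cons _ (cons _ (cons _ (cons _ (cons _ _))))) (s≤s (s≤s (s≤s (s≤s ())))) _

  data EdgePair (e f : Edge n) : Set where
    same  : e ≡ f → EdgePair e f
    meet  : ∀ {x} → e ≢ f → x ∈ₑ e → x ∈ₑ f → EdgePair e f
    apart : Disjoint e f → EdgePair e f

  compare-edges : ∀ e f → EdgePair e f
  compare-edges e@((a , b) , _) f with e ≟ₑ f | a ∈ₑ? f | b ∈ₑ? f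
  ... | yes e≡f | _       | _       = same e≡f
  ... | no e≢f  | yes a∈f | _       = meet e≢f (inj₁ refl) a∈f
  ... | no e≢f  | no _    | yes b∈f = meet e≢f (inj₂ refl) b∈f
  ... | no _    | no a∉f  | no b∉f  = apart λ { (inj₁ refl) → a∉f ; (inj₂ refl) → b∉f }

  mid-blocks-endpoints : ∀ {Y i j e} → i ≢ j → i ∈ₑ e → j ∈ₑ e → mid e ∈ Y →
                         ¬ Visible (SK n) Y (orig i) (orig j)
  mid-blocks-endpoints {Y} i≢j i∈e j∈e e∈Y visible with visible⇒clear Y i≢j visible
  ... | m , i∈m , j∈m , m∉Y = m∉Y (subst (λ m → mid m ∈ Y) (∈ₑ-unique _ m i≢j i∈e j∈e i∈m j∈m) e∈Y)

  -- The empty set and the set of branch vertices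

  clear-∅ : ∀ {i j} → i ≢ j → Clear [] i j
  clear-∅ i≢j = clear-via-edge [] i≢j λ ()

  route-∅ : ∀ {i e} → i ∉ₑ e → Route [] i e
  route-∅ i∉e = _ , inj₁ refl , (λ ()) , clear-∅ (λ i≡a → i∉e (inj₁ i≡a))

  ∅-total : IsTotalMutualVisibility (SK n) []
  ∅-total (orig i) (orig j) with i F.≟ j
  ... | yes refl = visible-refl
  ... | no i≢j   = clear⇒visible [] i≢j (clear-∅ i≢j)
  ∅-total (orig i) (mid e)  = orig-mid
    where
    orig-mid : Visible (SK n) [] (orig i) (mid e)
    orig-mid with i ∈ₑ? e
    ... | yes i∈e = visible-adjacent {G = SK n} (λ ()) i∈e
    ... | no i∉e  = route⇒visible [] i∉e (route-∅ {e = e} i∉e)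
  ∅-total (mid e) (orig i)  = visible-sym SK-sym (∅-total (orig i) (mid e))
  ∅-total (mid e) (mid f) with compare-edges e f
  ... | same refl         = visible-refl
  ... | meet e≢f x∈e x∈f  = junction⇒visible [] e≢f x∈e x∈f λ ()
  ... | apart e∩f=∅       =
    edgeRoute⇒visible [] e∩f=∅ (proj₁ (proj₁ e) , inj₁ refl , (λ ()) , route-∅ {e = f} (e∩f=∅ (inj₁ refl)))

  three-distinct : 3 ≤ n → (i : Fin n) → Σ[ j ∈ Fin n ] Σ[ k ∈ Fin n ] i ≢ j × i ≢ k × j ≢ k
  three-distinct (s≤s (s≤s (s≤s _))) F.zero            = F.suc F.zero , F.suc (F.suc F.zero) , (λ ()) , (λ ()) , λ ()
  three-distinct (s≤s (s≤s (s≤s _))) (F.suc F.zero)    = F.zero , F.suc (F.suc F.zero) , (λ ()) , (λ ()) , λ ()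
  three-distinct (s≤s (s≤s (s≤s _))) (F.suc (F.suc _)) = F.zero , F.suc F.zero , (λ ()) , (λ ()) , λ ()

  occupied-not-total : 3 ≤ n → ∀ {Y v} → v ∈ Y → ¬ IsTotalMutualVisibility (SK n) Y
  occupied-not-total 3≤n {Y} {orig i} i∈Y total with three-distinct 3≤n i
  ... | j , k , i≢j , i≢k , j≢k =
    visible⇒free-junction Y e≢f (∈-edgeˡ i j i≢j) (∈-edgeˡ i k i≢k) (total _ _) i∈Y
    where
    e≢f : edge i j i≢j ≢ edge i k i≢k
    e≢f e≡f with ∈ₑ-two (edge i j i≢j) i≢j (∈-edgeˡ i j i≢j) (∈-edgeʳ i j i≢j)
                   (subst (k ∈ₑ_) (sym e≡f) (∈-edgeʳ i k i≢k))
    ... | inj₁ k≡i = i≢k (sym k≡i)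
    ... | inj₂ k≡j = j≢k (sym k≡j)
  occupied-not-total _ {v = mid ((a , b) , a<b)} e∈Y total =
    mid-blocks-endpoints (FP.<⇒≢ a<b) (inj₁ refl) (inj₂ refl) e∈Y (total _ _)

  ∅-maximal-total : 3 ≤ n → IsMaximal (SK n) (IsTotalMutualVisibility (SK n)) []
  ∅-maximal-total 3≤n = [] , ∅-total , λ { _ _ (_ , _ , v∈Y , _) → occupied-not-total 3≤n v∈Y }

  branch-vertices : List (SKV n)
  branch-vertices = map orig (allFin n)

  orig∈branch-vertices : ∀ i → orig i ∈ branch-vertices
  orig∈branch-vertices i = ∈-map⁺ orig (∈-allFin i)

  mid∉branch-vertices : ∀ {e} → mid e ∉ branch-vertices
  mid∉branch-vertices e∈ with ∈-map⁻ orig e∈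
  ... | _ , _ , ()

  length-branch-vertices : length branch-vertices ≡ n
  length-branch-vertices = trans (LP.length-map orig (allFin n)) (LP.length-tabulate id)

  branch-vertices-maximal : IsMaximal (SK n) (IsMutualVisibility (SK n)) branch-vertices
  branch-vertices-maximal = unique , visible , maximal
    where
    unique : Unique branch-vertices
    unique = UP.map⁺ (λ { refl → refl }) (UP.allFin⁺ n)
    visible : IsMutualVisibility (SK n) branch-vertices
    visible (orig i) (orig j) _ _ with i F.≟ j
    ... | yes refl = visible-refl
    ... | no i≢j   = clear⇒visible branch-vertices i≢j (clear-via-edge branch-vertices i≢j mid∉branch-vertices)
    visible (mid _) _ e∈ _ = ⊥-elim (mid∉branch-vertices e∈)
    visible _ (mid _) _ e∈ = ⊥-elim (mid∉branch-vertices e∈)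
    maximal : ∀ Y → Unique Y → ProperSuperset (SK n) Y branch-vertices → ¬ IsMutualVisibility (SK n) Y
    maximal _ _ (_ , orig i , _ , i∉) _ = i∉ (orig∈branch-vertices i)
    maximal _ _ (⊆Y , mid ((a , b) , a<b) , e∈Y , _) visible =
      mid-blocks-endpoints (FP.<⇒≢ a<b) (inj₁ refl) (inj₂ refl) e∈Y
        (visible _ _ (⊆Y (orig∈branch-vertices a)) (⊆Y (orig∈branch-vertices b)))

  -- Adding a branch vertex to a mutual-visibility set

  endpoints-not-both-occupied : ∀ {X e y z} → IsMutualVisibility (SK n) X → mid e ∈ X →
                                y ≢ z → y ∈ₑ e → z ∈ₑ e → orig y ∈ X → orig z ∉ X
  endpoints-not-both-occupied visible e∈X y≢z y∈e z∈e y∈X z∈X =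
    mid-blocks-endpoints y≢z y∈e z∈e e∈X (visible _ _ y∈X z∈X)

  free-endpoint : ∀ {X w} e → IsMutualVisibility (SK n) X → mid e ∈ X →
                  (∀ {k} → Joined X w k → orig k ∉ X) → Σ[ j ∈ Fin n ] j ∈ₑ e × orig j ∉ X × j ≢ w
  free-endpoint {X} {w} e@((a , b) , a<b) visible e∈X w-free with w ∈ₑ? e | orig a ∈? X
  ... | yes w∈e | _ with partner e w∈e
  ...   | j , j∈e , j≢w = j , j∈e , w-free (e , e∈X , w∈e , j∈e) , j≢w
  free-endpoint e visible e∈X _ | no w∉e | no a∉X  = _ , inj₁ refl , a∉X , ∈ₑ∧∉ₑ⇒≢ e (inj₁ refl) w∉e
  free-endpoint e@((a , b) , a<b) visible e∈X _ | no w∉e | yes a∈X =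
    b , inj₂ refl , endpoints-not-both-occupied visible e∈X (FP.<⇒≢ a<b) (inj₁ refl) (inj₂ refl) a∈X ,
    ∈ₑ∧∉ₑ⇒≢ e (inj₂ refl) w∉e

  module _ {X : List (SKV n)} {u : Fin n} where

    -- Adding u can only block geodesics through u; the fields supply witnesses avoiding it.
    record Extendable : Set where
      field
        clear-to-occupied  : ∀ {i} → orig i ∈ X → Clear X u i
        route-to-edge      : ∀ {e} → mid e ∈ X → u ∉ₑ e → Route X u e
        route-avoiding     : ∀ {i e} → orig i ∈ X → mid e ∈ X → i ∉ₑ e → Route (orig u ∷ X) i e
        junction-avoiding  : ∀ {x e f} → mid e ∈ X → mid f ∈ X → e ≢ f → x ∈ₑ e → x ∈ₑ f → x ≢ u
        edgeRoute-avoiding : ∀ {e f} → mid e ∈ X → mid f ∈ X → Disjoint e f → EdgeRoute (orig u ∷ X) e f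

    clear-∷ : ∀ {i j} → Clear X i j → Clear (orig u ∷ X) i j
    clear-∷ (m , i∈m , j∈m , m∉) = m , i∈m , j∈m , ∉-∷ (λ ()) m∉

    route-∷ : ∀ {i e} (r : Route X i e) → proj₁ r ≢ u → Route (orig u ∷ X) i e
    route-∷ (j , j∈e , j∉ , c) j≢u = j , j∈e , ∉-∷ (λ { refl → j≢u refl }) j∉ , clear-∷ c

    edgeRoute-∷ : ∀ {e f} → u ∉ₑ e → u ∉ₑ f → EdgeRoute X e f → EdgeRoute (orig u ∷ X) e f
    edgeRoute-∷ {f = f} u∉e u∉f (x , x∈e , x∉ , r@(_ , y∈f , _)) =
      x , x∈e , ∉-∷ (λ { refl → u∉e x∈e }) x∉ , route-∷ {e = f} r (∈ₑ∧∉ₑ⇒≢ f y∈f u∉f)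

    module _ (visible : IsMutualVisibility (SK n) X) (u∉X : orig u ∉ X) (ext : Extendable) where
      open Extendable ext

      visible-from-u : ∀ b → b ∈ X → Visible (SK n) (orig u ∷ X) (orig u) b
      visible-from-u (orig i) i∈X =
        clear⇒visible _ (λ { refl → u∉X i∈X }) (clear-∷ (clear-to-occupied i∈X))
      visible-from-u (mid e) e∈X with u ∈ₑ? e
      ... | yes u∈e = visible-adjacent {G = SK n} (λ ()) u∈e
      ... | no u∉e  = route⇒visible _ u∉e (route-∷ {e = e} r (∈ₑ∧∉ₑ⇒≢ e (proj₁ (proj₂ r)) u∉e))
        where
        r : Route X u e
        r = route-to-edge e∈X u∉e

      visible-orig-mid : ∀ {i e} → orig i ∈ X → mid e ∈ X → Visible (SK n) (orig u ∷ X) (orig i) (mid e)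
      visible-orig-mid {i} {e} i∈X e∈X with i ∈ₑ? e
      ... | yes i∈e = visible-adjacent {G = SK n} (λ ()) i∈e
      ... | no i∉e  = route⇒visible _ i∉e (route-avoiding i∈X e∈X i∉e)

      visible-within : ∀ a b → a ∈ X → b ∈ X → Visible (SK n) (orig u ∷ X) a b
      visible-within (orig i) (orig j) i∈X j∈X with i F.≟ j
      ... | yes refl = visible-refl
      ... | no i≢j   = clear⇒visible _ i≢j (clear-∷ (visible⇒clear X i≢j (visible _ _ i∈X j∈X)))
      visible-within (orig _) (mid _)  i∈X e∈X = visible-orig-mid i∈X e∈X
      visible-within (mid _)  (orig _) e∈X i∈X = visible-sym SK-sym (visible-orig-mid i∈X e∈X)
      visible-within (mid e)  (mid f)  e∈X f∈X with compare-edges e f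
      ... | same refl        = visible-refl
      ... | meet e≢f x∈e x∈f =
        junction⇒visible _ e≢f x∈e x∈f
          (∉-∷ (λ { refl → junction-avoiding e∈X f∈X e≢f x∈e x∈f refl })
               (visible⇒free-junction X e≢f x∈e x∈f (visible _ _ e∈X f∈X)))
      ... | apart e∩f=∅      = edgeRoute⇒visible _ e∩f=∅ (edgeRoute-avoiding e∈X f∈X e∩f=∅)

      extend : IsMutualVisibility (SK n) (orig u ∷ X)
      extend _ _ (here refl)  (here refl)  = visible-refl
      extend _ b (here refl)  (there b∈X) = visible-from-u b b∈X
      extend a _ (there a∈X) (here refl)  = visible-sym SK-sym (visible-from-u a a∈X)
      extend a b (there a∈X) (there b∈X) = visible-within a b a∈X b∈X

  isolated-extendable : ∀ {X u} → IsMutualVisibility (SK n) X → orig u ∉ X →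
                        (∀ {e} → mid e ∈ X → u ∉ₑ e) → Extendable {X = X} {u = u}
  isolated-extendable {X} {u} visible u∉X isolated = record
    { clear-to-occupied  = λ i∈X → clear-from-u (λ { refl → u∉X i∈X })
    ; route-to-edge      = route-to-edge
    ; route-avoiding     = route-avoiding
    ; junction-avoiding  = λ {_} {e} e∈X _ _ x∈e _ → ∈ₑ∧∉ₑ⇒≢ e x∈e (isolated e∈X)
    ; edgeRoute-avoiding = λ {e} {f} e∈X f∈X e∩f=∅ →
        edgeRoute-∷ {e = e} {f = f} (isolated e∈X) (isolated f∈X)
          (visible⇒edgeRoute X e∩f=∅ (visible _ _ e∈X f∈X))
    }
    where
    clear-from-u : ∀ {j} → u ≢ j → Clear X u j
    clear-from-u u≢j = clear-via-edge X u≢j λ m∈X → isolated m∈X (∈-edgeˡ _ _ u≢j)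
    no-neighbour : ∀ {k} → Joined X u k → orig k ∉ X
    no-neighbour (_ , m∈X , u∈m , _) = ⊥-elim (isolated m∈X u∈m)
    route-to-edge : ∀ {e} → mid e ∈ X → u ∉ₑ e → Route X u e
    route-to-edge {e} e∈X _ with free-endpoint e visible e∈X no-neighbour
    ... | j , j∈e , j∉X , j≢u = j , j∈e , j∉X , clear-from-u (≢-sym j≢u)
    route-avoiding : ∀ {i e} → orig i ∈ X → mid e ∈ X → i ∉ₑ e → Route (orig u ∷ X) i e
    route-avoiding {e = e} i∈X e∈X i∉e with visible⇒route X i∉e (visible _ _ i∈X e∈X)
    ... | r@(_ , j∈e , _) = route-∷ {e = e} r (∈ₑ∧∉ₑ⇒≢ e j∈e (isolated e∈X))

  -- u is a leaf of the graph of X, hanging from w by the edge e. The conditions on w make every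
  -- edge of X that misses u and w reachable from w (route-from-w).
  module _ {X : List (SKV n)} {u w : Fin n} {e : Edge n}
           (visible : IsMutualVisibility (SK n) X) (u∉X : orig u ∉ X)
           (e∈X : mid e ∈ X) (u∈e : u ∈ₑ e) (w∈e : w ∈ₑ e) (w≢u : w ≢ u)
           (u-leaf : ∀ {f} → mid f ∈ X → u ∈ₑ f → f ≡ e)
           (w-free : ∀ {k} → Joined X w k → orig k ∉ X)
           (neighbours-free : ∀ {l k} → Joined X w l → l ≢ u → Joined X l k → orig k ∉ X)
           (no-triangle : ∀ {k l} → k ≢ l → k ≢ u → l ≢ u → k ≢ w → l ≢ w →
                          Joined X w k → Joined X w l → Joined X k l → ⊥)
           where

    private
      w∉X : orig w ∉ X
      w∉X = w-free (e , e∈X , w∈e , w∈e)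

      clear-from-u : ∀ {j} → j ≢ u → j ≢ w → Clear X u j
      clear-from-u {j} j≢u j≢w with clear⊎joined X (≢-sym j≢u)
      ... | inj₁ c = c
      ... | inj₂ (m , m∈X , u∈m , j∈m) with u-leaf m∈X u∈m
      ...   | refl = ⊥-elim ([ j≢u , j≢w ]′ (∈ₑ-two e (≢-sym w≢u) u∈e w∈e j∈m))

      clear-to-w : ∀ {i} → orig i ∈ X → Clear X i w
      clear-to-w i∈X with clear⊎joined X (λ { refl → w∉X i∈X })
      ... | inj₁ c                  = c
      ... | inj₂ (m , m∈X , i∈m , w∈m) = ⊥-elim (w-free (m , m∈X , w∈m , i∈m) i∈X)

      beside-occupied : ∀ {g y z} → mid g ∈ X → u ∉ₑ g → w ∉ₑ g → y ∈ₑ g → z ∈ₑ g → z ≢ y → orig z ∈ X →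
                        Σ[ y ∈ Fin n ] y ∈ₑ g × orig y ∉ X × y ≢ u × Clear X w y
      beside-occupied {g} {y} g∈X u∉g w∉g y∈g z∈g z≢y z∈X with clear⊎joined X (∈ₑ∧∉ₑ⇒≢ g y∈g w∉g ∘ sym)
      ... | inj₁ c  = y , y∈g , endpoints-not-both-occupied visible g∈X z≢y z∈g y∈g z∈X , y≢u , c
        where y≢u = ∈ₑ∧∉ₑ⇒≢ g y∈g u∉g
      ... | inj₂ wy = ⊥-elim (neighbours-free wy (∈ₑ∧∉ₑ⇒≢ g y∈g u∉g) (g , g∈X , y∈g , z∈g) z∈X)

      route-from-w : ∀ {g} → mid g ∈ X → u ∉ₑ g → w ∉ₑ g →
                     Σ[ y ∈ Fin n ] y ∈ₑ g × orig y ∉ X × y ≢ u × Clear X w y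
      route-from-w {g@((k , l) , k<l)} g∈X u∉g w∉g with orig k ∈? X | orig l ∈? X
      ... | yes k∈X | _       = beside-occupied g∈X u∉g w∉g (inj₂ refl) (inj₁ refl) (FP.<⇒≢ k<l) k∈X
      ... | no _    | yes l∈X = beside-occupied g∈X u∉g w∉g (inj₁ refl) (inj₂ refl) (≢-sym (FP.<⇒≢ k<l)) l∈X
      ... | no k∉X  | no l∉X  = both-free k∉X l∉X
        where
        off : ∀ {y x} → y ∈ₑ g → x ∉ₑ g → y ≢ x
        off = ∈ₑ∧∉ₑ⇒≢ g
        both-free : orig k ∉ X → orig l ∉ X → Σ[ y ∈ Fin n ] y ∈ₑ g × orig y ∉ X × y ≢ u × Clear X w y
        both-free k∉X l∉X with clear⊎joined X (≢-sym (off (inj₁ refl) w∉g))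
                             | clear⊎joined X (≢-sym (off (inj₂ refl) w∉g))
        ... | inj₁ c  | _       = k , inj₁ refl , k∉X , off (inj₁ refl) u∉g , c
        ... | inj₂ _  | inj₁ c  = l , inj₂ refl , l∉X , off (inj₂ refl) u∉g , c
        ... | inj₂ wk | inj₂ wl = ⊥-elim (no-triangle (FP.<⇒≢ k<l)
          (off (inj₁ refl) u∉g) (off (inj₂ refl) u∉g) (off (inj₁ refl) w∉g) (off (inj₂ refl) w∉g)
          wk wl (g , g∈X , inj₁ refl , inj₂ refl))

      edgeRoute-from-e : ∀ {g} → mid g ∈ X → Disjoint e g → EdgeRoute (orig u ∷ X) e g
      edgeRoute-from-e g∈X e∩g=∅ with route-from-w g∈X (e∩g=∅ u∈e) (e∩g=∅ w∈e)
      ... | y , y∈g , y∉X , y≢u , c =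
        w , w∈e , ∉-∷ (λ { refl → w≢u refl }) w∉X , y , y∈g , ∉-∷ (λ { refl → y≢u refl }) y∉X , clear-∷ c

      route-to-edge : ∀ {f} → mid f ∈ X → u ∉ₑ f → Route X u f
      route-to-edge {f} f∈X u∉f with free-endpoint f visible f∈X w-free
      ... | j , j∈f , j∉X , j≢w = j , j∈f , j∉X , clear-from-u (∈ₑ∧∉ₑ⇒≢ f j∈f u∉f) j≢w

      route-avoiding : ∀ {i f} → orig i ∈ X → mid f ∈ X → i ∉ₑ f → Route (orig u ∷ X) i f
      route-avoiding {f = f} i∈X f∈X i∉f with visible⇒route X i∉f (visible _ _ i∈X f∈X)
      ... | r@(j , j∈f , _) with j F.≟ u
      ...   | no j≢u   = route-∷ {e = f} r j≢u
      ...   | yes refl with u-leaf f∈X j∈f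
      ...     | refl = w , w∈e , ∉-∷ (λ { refl → w≢u refl }) w∉X , clear-∷ (clear-to-w i∈X)

      edgeRoute-avoiding : ∀ {f g} → mid f ∈ X → mid g ∈ X → Disjoint f g → EdgeRoute (orig u ∷ X) f g
      edgeRoute-avoiding {f} {g} f∈X g∈X f∩g=∅ with u ∈ₑ? f | u ∈ₑ? g
      ... | yes u∈f | _ with u-leaf f∈X u∈f
      ...   | refl = edgeRoute-from-e g∈X f∩g=∅
      edgeRoute-avoiding {f} {g} f∈X g∈X f∩g=∅ | no _ | yes u∈g with u-leaf g∈X u∈g
      ...   | refl = edgeRoute-sym _ {e = e} {f = f} (edgeRoute-from-e f∈X (λ x∈e x∈f → f∩g=∅ x∈f x∈e))
      edgeRoute-avoiding {f} {g} f∈X g∈X f∩g=∅ | no u∉f | no u∉g =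
        edgeRoute-∷ {e = f} {f = g} u∉f u∉g (visible⇒edgeRoute X f∩g=∅ (visible _ _ f∈X g∈X))

    leaf-extendable : Extendable {X = X} {u = u}
    leaf-extendable = record
      { clear-to-occupied  = λ i∈X → clear-from-u (λ { refl → u∉X i∈X }) (λ { refl → w∉X i∈X })
      ; route-to-edge      = route-to-edge
      ; route-avoiding     = route-avoiding
      ; junction-avoiding  = λ f∈X g∈X f≢g x∈f x∈g →
          λ { refl → f≢g (trans (u-leaf f∈X x∈f) (sym (u-leaf g∈X x∈g))) }
      ; edgeRoute-avoiding = edgeRoute-avoiding
      }

  -- Charging the branch vertices to a maximal mutual-visibility set

  module _ {X : List (SKV n)} where

    someEdge? : ∀ {P : Edge n → Set} → (∀ e → Dec (P e)) → Dec (Σ[ e ∈ Edge n ] mid e ∈ X × P e)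
    someEdge? {P} P? = map′ from to (any? onMid? X)
      where
      OnMid : SKV n → Set
      OnMid (orig _) = ⊥
      OnMid (mid e)  = P e
      onMid? : ∀ s → Dec (OnMid s)
      onMid? (orig _) = no λ ()
      onMid? (mid e)  = P? e
      from : Any OnMid X → Σ[ e ∈ Edge n ] mid e ∈ X × P e
      from any with find any
      ... | mid e , e∈X , pe = e , e∈X , pe
      to : Σ[ e ∈ Edge n ] mid e ∈ X × P e → Any OnMid X
      to (_ , e∈X , pe) = lose e∈X pe

    everyEdge? : ∀ {P : Edge n → Set} → (∀ e → Dec (P e)) → Dec (∀ {e} → mid e ∈ X → P e)
    everyEdge? P? =
      map′ (λ ¬counterexample {e} e∈X → decidable-stable (P? e) λ ¬pe → ¬counterexample (e , e∈X , ¬pe))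
           (λ all (e , e∈X , ¬pe) → ¬pe (all e∈X))
           (¬? (someEdge? (¬? ∘ P?)))

    Joined? : ∀ i j → Dec (Joined X i j)
    Joined? i j = someEdge? λ e → (i ∈ₑ? e) ×-dec (j ∈ₑ? e)

    NearOccupied : Fin n → Set
    NearOccupied v = Σ[ o ∈ Fin n ] Joined X v o × orig o ∈ X

    NearOccupied? : ∀ v → Dec (NearOccupied v)
    NearOccupied? v = FP.any? λ o → Joined? v o ×-dec (orig o ∈? X)

    Leaf : Fin n → Set
    Leaf v = Σ[ e ∈ Edge n ] mid e ∈ X × v ∈ₑ e × (∀ {f} → mid f ∈ X → v ∈ₑ f → f ≡ e)

    Leaf? : ∀ v → Dec (Leaf v)
    Leaf? v = someEdge? λ e → (v ∈ₑ? e) ×-dec everyEdge? (λ f → (v ∈ₑ? f) →-dec (f ≟ₑ e))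

    TwoNonLeafNeighbours : Fin n → Set
    TwoNonLeafNeighbours v = Σ[ k ∈ Fin n ] Σ[ l ∈ Fin n ]
      k ≢ l × k ≢ v × l ≢ v × Joined X v k × Joined X v l × ¬ Leaf k × ¬ Leaf l

    TwoNonLeafNeighbours? : ∀ v → Dec (TwoNonLeafNeighbours v)
    TwoNonLeafNeighbours? v = FP.any? λ k → FP.any? λ l →
      ¬? (k F.≟ l) ×-dec ¬? (k F.≟ v) ×-dec ¬? (l F.≟ v) ×-dec Joined? v k ×-dec Joined? v l ×-dec
      ¬? (Leaf? k) ×-dec ¬? (Leaf? l)

    leaf-edge-unique : ∀ {v e f} → Leaf v → mid e ∈ X → v ∈ₑ e → mid f ∈ X → v ∈ₑ f → f ≡ e
    leaf-edge-unique (_ , _ , _ , only) e∈X v∈e f∈X v∈f = trans (only f∈X v∈f) (sym (only e∈X v∈e))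

    two-neighbours⇒¬Leaf : ∀ {x a b} → a ≢ b → a ≢ x → b ≢ x → Joined X x a → Joined X x b → ¬ Leaf x
    two-neighbours⇒¬Leaf a≢b a≢x b≢x (e , e∈X , x∈e , a∈e) (f , f∈X , x∈f , b∈f) leaf
      with leaf-edge-unique leaf e∈X x∈e f∈X x∈f
    ... | refl = [ b≢x , ≢-sym a≢b ]′ (∈ₑ-two e (≢-sym a≢x) x∈e a∈e b∈f)

    other-edge : ∀ {v e} → ¬ Leaf v → mid e ∈ X → v ∈ₑ e → Σ[ f ∈ Edge n ] mid f ∈ X × v ∈ₑ f × f ≢ e
    other-edge {v} {e} ¬leaf e∈X v∈e with someEdge? (λ f → (v ∈ₑ? f) ×-dec ¬? (f ≟ₑ e))
    ... | yes (f , f∈X , v∈f , f≢e) = f , f∈X , v∈f , f≢e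
    ... | no none = ⊥-elim (¬leaf (e , e∈X , v∈e , λ {f} f∈X v∈f →
                      decidable-stable (f ≟ₑ e) λ f≢e → none (f , f∈X , v∈f , f≢e)))

    data Oriented (v w : Fin n) : Edge n → Set where
      forward  : ∀ {p} → Oriented v w ((v , w) , p)
      backward : ∀ {p} → Oriented v w ((w , v) , p)

    oriented : ∀ {v w} e → v ∈ₑ e → w ∈ₑ e → w ≢ v → Oriented v w e
    oriented _ (inj₁ refl) (inj₂ refl) _   = forward
    oriented _ (inj₂ refl) (inj₁ refl) _   = backward
    oriented _ (inj₁ refl) (inj₁ refl) w≢v = ⊥-elim (w≢v refl)
    oriented _ (inj₂ refl) (inj₂ refl) w≢v = ⊥-elim (w≢v refl)

    -- Both halves of an edge of X go to the endpoint that may need the whole edge (in order of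
    -- priority: its partner is in X, it is a leaf, its partner is next to X); otherwise they are split.
    edgeOwner : Edge n → Bool → Fin n
    edgeOwner ((a , b) , _) β =
      if does (orig a ∈? X) then b else if does (orig b ∈? X) then a else
      if does (Leaf? a) then a else if does (Leaf? b) then b else
      if does (NearOccupied? a) then b else if does (NearOccupied? b) then a else
      if β then a else b

    owner : SKV n × Bool → Fin n
    owner (orig i , _) = i
    owner (mid e  , β) = edgeOwner e β

    side : Fin n → Edge n → Bool
    side v ((a , _) , _) = does (v F.≟ a)

    owner-occupied-partner : ∀ {v w e} → Oriented v w e → orig v ∉ X → orig w ∈ X →
                             ∀ β → owner (mid e , β) ≡ v
    owner-occupied-partner {v} {w} forward v∉X w∈X _
      rewrite dec-false (orig v ∈? X) v∉X | dec-true (orig w ∈? X) w∈X = refl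
    owner-occupied-partner {v} {w} backward v∉X w∈X _
      rewrite dec-true (orig w ∈? X) w∈X = refl

    owner-leaf : ∀ {v w e} → Oriented v w e → orig v ∉ X → orig w ∉ X → Leaf v → ¬ Leaf w →
                 ∀ β → owner (mid e , β) ≡ v
    owner-leaf {v} {w} forward v∉X w∉X leaf ¬leaf _
      rewrite dec-false (orig v ∈? X) v∉X | dec-false (orig w ∈? X) w∉X | dec-true (Leaf? v) leaf = refl
    owner-leaf {v} {w} backward v∉X w∉X leaf ¬leaf _
      rewrite dec-false (orig w ∈? X) w∉X | dec-false (orig v ∈? X) v∉X
            | dec-false (Leaf? w) ¬leaf | dec-true (Leaf? v) leaf = refl

    owner-partner-near : ∀ {v w e} → Oriented v w e → orig v ∉ X → orig w ∉ X → ¬ Leaf v → ¬ Leaf w →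
                        ¬ NearOccupied v → NearOccupied w → ∀ β → owner (mid e , β) ≡ v
    owner-partner-near {v} {w} forward v∉X w∉X ¬leafv ¬leafw ¬nearv nearw _
      rewrite dec-false (orig v ∈? X) v∉X | dec-false (orig w ∈? X) w∉X
            | dec-false (Leaf? v) ¬leafv | dec-false (Leaf? w) ¬leafw
            | dec-false (NearOccupied? v) ¬nearv | dec-true (NearOccupied? w) nearw = refl
    owner-partner-near {v} {w} backward v∉X w∉X ¬leafv ¬leafw ¬nearv nearw _
      rewrite dec-false (orig w ∈? X) w∉X | dec-false (orig v ∈? X) v∉X
            | dec-false (Leaf? w) ¬leafw | dec-false (Leaf? v) ¬leafv
            | dec-true (NearOccupied? w) nearw = refl

    owner-side : ∀ {v w e} → Oriented v w e → orig v ∉ X → orig w ∉ X → ¬ Leaf v → ¬ Leaf w →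
                 ¬ NearOccupied v → ¬ NearOccupied w → owner (mid e , side v e) ≡ v
    owner-side {v} {w} forward v∉X w∉X ¬leafv ¬leafw ¬nearv ¬nearw
      rewrite dec-false (orig v ∈? X) v∉X | dec-false (orig w ∈? X) w∉X
            | dec-false (Leaf? v) ¬leafv | dec-false (Leaf? w) ¬leafw
            | dec-false (NearOccupied? v) ¬nearv | dec-false (NearOccupied? w) ¬nearw
            | dec-true (v F.≟ v) refl = refl
    owner-side {v} {w} (backward {w<v}) v∉X w∉X ¬leafv ¬leafw ¬nearv ¬nearw
      rewrite dec-false (orig w ∈? X) w∉X | dec-false (orig v ∈? X) v∉X
            | dec-false (Leaf? w) ¬leafw | dec-false (Leaf? v) ¬leafv
            | dec-false (NearOccupied? w) ¬nearw | dec-false (NearOccupied? v) ¬nearv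
            | dec-false (v F.≟ w) (≢-sym (FP.<⇒≢ w<v)) = refl

    record Tokens (v : Fin n) : Set where
      field
        t₁ t₂    : SKV n × Bool
        t₁∈X     : proj₁ t₁ ∈ X
        t₂∈X     : proj₁ t₂ ∈ X
        owner-t₁ : owner t₁ ≡ v
        owner-t₂ : owner t₂ ≡ v
        t₁≢t₂    : t₁ ≢ t₂

    both-halves : ∀ {v s} → s ∈ X → (∀ β → owner (s , β) ≡ v) → Tokens v
    both-halves s∈X owns = record
      { t₁ = _ , true ; t₂ = _ , false ; t₁∈X = s∈X ; t₂∈X = s∈X
      ; owner-t₁ = owns true ; owner-t₂ = owns false ; t₁≢t₂ = λ () }

    module _ (unique : Unique X) (visible : IsMutualVisibility (SK n) X)
             (maximal : ∀ Y → Unique Y → ProperSuperset (SK n) Y X → ¬ IsMutualVisibility (SK n) Y) where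

      not-extendable : ∀ {u} → orig u ∉ X → ¬ Extendable {X = X} {u = u}
      not-extendable u∉X ext =
        maximal _ (¬Any⇒All¬ X u∉X ∷ unique) (there , _ , here refl , u∉X) (extend visible u∉X ext)

      module _ {v : Fin n} (v∉X : orig v ∉ X) (¬near : ¬ NearOccupied v) where

        partner-free : ∀ {w} → Joined X v w → orig w ∉ X
        partner-free vw w∈X = ¬near (_ , vw , w∈X)

        tokens-leaf : Leaf v → Tokens v
        tokens-leaf leaf@(e , e∈X , v∈e , only) with partner e v∈e
        ... | w , w∈e , w≢v with Leaf? w
        ...   | no ¬leafw = both-halves e∈X
          (owner-leaf (oriented e v∈e w∈e w≢v) v∉X (partner-free (e , e∈X , v∈e , w∈e)) leaf ¬leafw)
        ...   | yes leafw = ⊥-elim (not-extendable v∉X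
          (leaf-extendable visible v∉X e∈X v∈e w∈e w≢v only w-free neighbours-free no-triangle))
          where
          on-e : ∀ {k} → Joined X w k → k ≡ v ⊎ k ≡ w
          on-e (f , f∈X , w∈f , k∈f) with leaf-edge-unique leafw e∈X w∈e f∈X w∈f
          ... | refl = ∈ₑ-two e (≢-sym w≢v) v∈e w∈e k∈f
          w-free : ∀ {k} → Joined X w k → orig k ∉ X
          w-free wk with on-e wk
          ... | inj₁ refl = v∉X
          ... | inj₂ refl = partner-free (e , e∈X , v∈e , w∈e)
          neighbours-free : ∀ {l k} → Joined X w l → l ≢ v → Joined X l k → orig k ∉ X
          neighbours-free wl l≢v lk with on-e wl
          ... | inj₁ l≡v  = ⊥-elim (l≢v l≡v)
          ... | inj₂ refl = w-free lk
          no-triangle : ∀ {k l} → k ≢ l → k ≢ v → l ≢ v → k ≢ w → l ≢ w →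
                        Joined X w k → Joined X w l → Joined X k l → ⊥
          no-triangle _ k≢v _ k≢w _ wk _ _ = [ k≢v , k≢w ]′ (on-e wk)

        tokens-neighbour-near : ¬ Leaf v → ∀ {y} → Joined X v y → NearOccupied y → Tokens v
        tokens-neighbour-near ¬leafv {y} vy@(e , e∈X , v∈e , y∈e) neary@(o , yo , o∈X) =
          both-halves e∈X
            (owner-partner-near (oriented e v∈e y∈e y≢v) v∉X (partner-free vy) ¬leafv ¬leafy ¬near neary)
          where
          y≢v : y ≢ v
          y≢v refl = ¬near neary
          ¬leafy : ¬ Leaf y
          ¬leafy = two-neighbours⇒¬Leaf (λ { refl → v∉X o∈X }) (≢-sym y≢v)
                     (λ { refl → partner-free vy o∈X }) (joined-sym X vy) yo

        tokens-split : ¬ Leaf v → (∀ {y} → Joined X v y → ¬ NearOccupied y) → TwoNonLeafNeighbours v →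
                       Tokens v
        tokens-split ¬leafv ¬near-nbr
          (k , l , k≢l , k≢v , l≢v , vk@(e , e∈X , v∈e , k∈e) , vl@(f , f∈X , v∈f , l∈f) , ¬leafk , ¬leafl) =
          record
          { t₁ = mid e , side v e ; t₂ = mid f , side v f ; t₁∈X = e∈X ; t₂∈X = f∈X
          ; owner-t₁ = owner-side (oriented e v∈e k∈e k≢v) v∉X (partner-free vk) ¬leafv ¬leafk
                                  ¬near (¬near-nbr vk)
          ; owner-t₂ = owner-side (oriented f v∈f l∈f l≢v) v∉X (partner-free vl) ¬leafv ¬leafl
                                  ¬near (¬near-nbr vl)
          ; t₁≢t₂ = λ { refl → [ l≢v , ≢-sym k≢l ]′ (∈ₑ-two e (≢-sym k≢v) v∈e k∈e l∈f) }
          }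

        leaf-neighbour-absurd : (∀ {y} → Joined X v y → ¬ NearOccupied y) → ¬ TwoNonLeafNeighbours v →
                                ∀ {u e} → Leaf u → mid e ∈ X → v ∈ₑ e → u ∈ₑ e → u ≢ v → ⊥
        leaf-neighbour-absurd ¬near-nbr ¬pair {u} {e} leafu e∈X v∈e u∈e u≢v =
          not-extendable u∉X
            (leaf-extendable visible u∉X e∈X u∈e v∈e (≢-sym u≢v)
               (λ f∈X u∈f → leaf-edge-unique leafu e∈X u∈e f∈X u∈f)
               partner-free (λ vl _ lk k∈X → ¬near-nbr vl (_ , lk , k∈X)) no-triangle)
          where
          u∉X : orig u ∉ X
          u∉X = partner-free (e , e∈X , v∈e , u∈e)
          no-triangle : ∀ {k l} → k ≢ l → k ≢ u → l ≢ u → k ≢ v → l ≢ v →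
                        Joined X v k → Joined X v l → Joined X k l → ⊥
          no-triangle k≢l _ _ k≢v l≢v vk vl kl = ¬pair
            (_ , _ , k≢l , k≢v , l≢v , vk , vl ,
             two-neighbours⇒¬Leaf (≢-sym l≢v) (≢-sym k≢v) (≢-sym k≢l)
               (joined-sym X vk) kl ,
             two-neighbours⇒¬Leaf (≢-sym k≢v) (≢-sym l≢v) k≢l
               (joined-sym X vl) (joined-sym X kl))

        ¬¬two-non-leaf-neighbours : ¬ Leaf v → (∀ {y} → Joined X v y → ¬ NearOccupied y) →
                                    ∀ {e} → mid e ∈ X → v ∈ₑ e → ¬ ¬ TwoNonLeafNeighbours v
        ¬¬two-non-leaf-neighbours ¬leafv ¬near-nbr {e} e∈X v∈e ¬pair
          with other-edge ¬leafv e∈X v∈e | partner e v∈e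
        ... | f , f∈X , v∈f , f≢e | k , k∈e , k≢v with partner f v∈f
        ...   | l , l∈f , l≢v with Leaf? k | Leaf? l
        ...     | yes leafk | _         = leaf-neighbour-absurd ¬near-nbr ¬pair leafk e∈X v∈e k∈e k≢v
        ...     | no _      | yes leafl = leaf-neighbour-absurd ¬near-nbr ¬pair leafl f∈X v∈f l∈f l≢v
        ...     | no ¬leafk | no ¬leafl =
          ¬pair (k , l , k≢l , k≢v , l≢v , (e , e∈X , v∈e , k∈e) , (f , f∈X , v∈f , l∈f) , ¬leafk , ¬leafl)
          where
          k≢l : k ≢ l
          k≢l refl = f≢e (∈ₑ-unique f e (≢-sym k≢v) v∈f l∈f v∈e k∈e)

        tokens-far : Tokens v
        tokens-far with someEdge? (v ∈ₑ?_)
        ... | no isolated = ⊥-elim (not-extendable v∉X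
              (isolated-extendable visible v∉X λ e∈X v∈e → isolated (_ , e∈X , v∈e)))
        ... | yes (e , e∈X , v∈e) with Leaf? v
        ...   | yes leaf  = tokens-leaf leaf
        ...   | no ¬leaf with FP.any? (λ y → Joined? v y ×-dec NearOccupied? y)
        ...     | yes (_ , vy , neary) = tokens-neighbour-near ¬leaf vy neary
        ...     | no ¬near-nbr′ =
          tokens-split ¬leaf ¬near-nbr
            (decidable-stable (TwoNonLeafNeighbours? v) (¬¬two-non-leaf-neighbours ¬leaf ¬near-nbr e∈X v∈e))
          where
          ¬near-nbr : ∀ {y} → Joined X v y → ¬ NearOccupied y
          ¬near-nbr vy neary = ¬near-nbr′ (_ , vy , neary)

      tokens : ∀ v → Tokens v
      tokens v with orig v ∈? X
      ... | yes v∈X = both-halves v∈X (λ _ → refl)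
      ... | no v∉X with NearOccupied? v
      ...   | no ¬near = tokens-far v∉X ¬near
      ...   | yes (o , (e , e∈X , v∈e , o∈e) , o∈X) =
        both-halves e∈X (owner-occupied-partner (oriented e v∈e o∈e (λ { refl → v∉X o∈X })) v∉X o∈X)

      token : Fin n ⊎ Fin n → SKV n × Bool
      token (inj₁ v) = Tokens.t₁ (tokens v)
      token (inj₂ v) = Tokens.t₂ (tokens v)

      owner-token : ∀ x → owner (token x) ≡ reduce x
      owner-token (inj₁ v) = Tokens.owner-t₁ (tokens v)
      owner-token (inj₂ v) = Tokens.owner-t₂ (tokens v)

      token-injective : ∀ {x y} → token x ≡ token y → x ≡ y
      token-injective {x} {y} eq with trans (sym (owner-token x)) (trans (cong owner eq) (owner-token y))
      token-injective {inj₁ _} {inj₁ _} _  | refl = refl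
      token-injective {inj₂ _} {inj₂ _} _  | refl = refl
      token-injective {inj₁ v} {inj₂ _} eq | refl = ⊥-elim (Tokens.t₁≢t₂ (tokens v) eq)
      token-injective {inj₂ v} {inj₁ _} eq | refl = ⊥-elim (Tokens.t₁≢t₂ (tokens v) (sym eq))

      halves : List (SKV n × Bool)
      halves = map (_, true) X ++ map (_, false) X

      ∈-halves : ∀ {s} β → s ∈ X → (s , β) ∈ halves
      ∈-halves true  s∈X = ∈-++⁺ˡ (∈-map⁺ (_, true) s∈X)
      ∈-halves false s∈X = ∈-++⁺ʳ (map (_, true) X) (∈-map⁺ (_, false) s∈X)

      token∈halves : ∀ x → token x ∈ halves
      token∈halves (inj₁ v) = ∈-halves _ (Tokens.t₁∈X (tokens v))
      token∈halves (inj₂ v) = ∈-halves _ (Tokens.t₂∈X (tokens v))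

      length-halves : length halves ≡ length X + length X
      length-halves =
        trans (LP.length-++ (map (_, true) X)) (cong₂ _+_ (LP.length-map _ X) (LP.length-map _ X))

      n≤length : n ≤ length X
      n≤length = m+m≤n+n⇒m≤n (subst (n + n ≤_) length-halves
        (injection⇒≤length (token ∘ F.splitAt n) (splitAt-injective ∘ token-injective)
                            (token∈halves ∘ F.splitAt n)))
        where
        splitAt-injective : ∀ {i j} → F.splitAt n i ≡ F.splitAt n j → i ≡ j
        splitAt-injective {i} {j} eq =
          trans (sym (FP.join-splitAt n n i)) (trans (cong (F.join n n) eq) (FP.join-splitAt n n j))

maximal⇒n≤length : ∀ {n} {X : List (SKV n)} →
                   IsMaximal (SK n) (IsMutualVisibility (SK n)) X → n ≤ length X
maximal⇒n≤length (unique , visible , maximal) = n≤length unique visible maximal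

theorem5p2 : ∀ (n : ℕ) → 3 ≤ n → MuTMinus (SK n) 0 × MuMinus (SK n) n
theorem5p2 n 3≤n =
  (([] , ∅-maximal-total 3≤n , refl) , λ _ _ → z≤n) ,
  ((branch-vertices , branch-vertices-maximal , length-branch-vertices) , λ _ → maximal⇒n≤length)
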